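{- Let $G$ be a finite connected undirected unweighted graph with node set $V$ and $r$ a ranking of $V$. Algorithm A (described in the context) terminates and outputs the values $e^U(v)=e(v)$ for all $v\in V$, a tight lower certificate $L$ with $L\subseteq a_r(V)$, and the upper certificate $U=U^{\preceq}$, where $U^{\preceq}$ is the set of nodes $x$ such that the only node $y$ with $e(x)=d(x,y)+e(y)$ is $y=x$ (this is the unique minimum-size tight upper certificate of $G$); it performs $|U^{\preceq}|+2|L|$ one-to-all distance queries.
   Context: $d$ is shortest-path distance, $e(u)=\max_v d(u,v)$. A ranking $r$ is an injective map $V\to\mathbb{N}$; the antipode $a_r(u)$ is the node $v$ maximizing $(d(u,v),r(v))$ lexicographically; $a_r(V)=\{a_r(u):u\in V\}$. $e_L(u)=\max_{x\in L}d(u,x)$ ($0$ if $L=\emptyset$); $e^U(u)=\min_{x\in U}(d(u,x)+e(x))$ ($\infty$ if $U=\emptyset$). $L$ is a tight lower certificate if $e_L(u)=e(u)$ for all $u$; $U$ is a tight upper certificate if $e^U(u)=e(u)$ for all $u$. A one-to-all distance query from $u$ returns $(d(u,v))_{v\in V}$. Algorithm A: maintain $L$ and $U$ (initially $\emptyset$) and the values $e_L(v)$, $e^U(v)$ for all $v$. Define $f(v,\ell)=\ell$ if $\ell<e^U(v)$ and $f(v,\ell)=\infty$ otherwise (w.r.t. the current $U$). Repeat: if $\min_{v\in V}f(v,e_L(v))=\infty$, halt and output $(e^U,L,U)$. Otherwise choose $u$ minimizing $f(v,e_L(v))$, query distances from $u$ and compute $e(u)$; if $e_L(u)<e(u)$,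 let $a=a_r(u)$, query distances from $a$, add $a$ to $L$, update $e_L(v):=\max(e_L(v),d(a,v))$ and repeat the selection; if $e_L(u)=e(u)$, add $u$ to $U$ and update $e^U(v):=\min(e^U(v),d(u,v)+e(u))$ for all $v$. -}

module Defs where

open import Data.Nat using (ℕ; zero; suc; _+_; _*_; _⊔_; _≤_; _<_; _<ᵇ_)
open import Data.Fin using (Fin)
open import Data.Fin.Subset using (Subset; _∈_; _∪_; ⁅_⁆; ∣_∣) renaming (⊥ to ∅)
open import Data.Vec using (lookup)
open import Data.List using (foldr; allFin)
open import Data.Bool using (Bool; true; false; if_then_else_)
open import Data.Product using (Σ; ∃; _×_; _,_)
open import Data.Sum using (_⊎_)
open import Function using (Injective)
open import Relation.Binary.PropositionalEquality using (_≡_)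
open import Relation.Binary.Construct.Closure.ReflexiveTransitive using (Star)
open import Induction.WellFounded using (Acc)
open import Relation.Nullary using (¬_)

record Graph (n : ℕ) : Set₁ where
  field
    Adj       : Fin n → Fin n → Set
    Adj-sym   : ∀ {u v} → Adj u v → Adj v u
    Adj-irrefl : ∀ {u} → ¬ Adj u u
open Graph public

data Walk {n : ℕ} (G : Graph n) : Fin n → Fin n → ℕ → Set where
  here : ∀ {u} → Walk G u u 0
  step : ∀ {u w v k} → Adj G u w → Walk G w v k → Walk G u v (suc k)

Connected : ∀ {n} → Graph n → Set
Connected G = ∀ u v → ∃ λ k → Walk G u v k

IsShortestPathDistance : ∀ {n} → Graph n → (Fin n → Fin n → ℕ) → Set
IsShortestPathDistance G d =
  ∀ u v → Walk G u v (d u v) × (∀ k → Walk G u v k → d u v ≤ k)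

data ℕ∞ : Set where
  fin : ℕ → ℕ∞
  ∞   : ℕ∞

data _≤∞_ : ℕ∞ → ℕ∞ → Set where
  fin≤fin : ∀ {m k} → m ≤ k → fin m ≤∞ fin k
  _≤∞∞    : ∀ x → x ≤∞ ∞

_⊓∞_ : ℕ∞ → ℕ∞ → ℕ∞
∞ ⊓∞ y = y
fin m ⊓∞ ∞ = fin m
fin m ⊓∞ fin k = if m <ᵇ k then fin m else fin k

module _ {n : ℕ} (d : Fin n → Fin n → ℕ) where

  ecc : Fin n → ℕ
  ecc u = foldr (λ v m → d u v ⊔ m) 0 (allFin n)

  eLower : Subset n → Fin n → ℕ
  eLower L u = foldr (λ x m → if lookup L x then d u x ⊔ m else m) 0 (allFin n)

  eUpper : Subset n → Fin n → ℕ∞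
  eUpper U u = foldr (λ x m → if lookup U x then fin (d u x + ecc x) ⊓∞ m else m) ∞ (allFin n)

  TightLower : Subset n → Set
  TightLower L = ∀ u → eLower L u ≡ ecc u

  TightUpper : Subset n → Set
  TightUpper U = ∀ u → eUpper U u ≡ fin (ecc u)

  -- a is the antipode a_r(u): it maximises (d(u,v), r(v)) lexicographically
  IsAntipode : (Fin n → ℕ) → Fin n → Fin n → Set
  IsAntipode r u a = ∀ v → d u v < d u a ⊎ (d u v ≡ d u a × r v ≤ r a)

  InUprec : Fin n → Set
  InUprec x = ∀ y → ecc x ≡ d x y + ecc y → y ≡ x

  -- Algorithm A as a (nondeterministic in the tie-breaking) transition system

  record State : Set where
    constructor st
    field
      L  : Subset n
      U  : Subset n
      eL : Fin n → ℕ
      eU : Fin n → ℕ∞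
      queries : ℕ
  open State public

  initial : State
  initial = st ∅ ∅ (λ _ → 0) (λ _ → ∞) 0

  fval : ℕ∞ → ℕ → ℕ∞
  fval ∞ ℓ = fin ℓ
  fval (fin m) ℓ = if ℓ <ᵇ m then fin ℓ else ∞

  fOf : State → Fin n → ℕ∞
  fOf s v = fval (eU s v) (eL s v)

  Halted : State → Set
  Halted s = ∀ v → fOf s v ≡ ∞

  Chosen : State → Fin n → Set
  Chosen s u = (∃ λ k → fOf s u ≡ fin k) × (∀ v → fOf s u ≤∞ fOf s v)

  data Step (r : Fin n → ℕ) : State → State → Set where
    -- e_L(u) < e(u): query from u and from a = a_r(u), add a to L
    stepL : ∀ {s u a} → Chosen s u → eL s u < ecc u → IsAntipode r u a →
            Step r s (st (L s ∪ ⁅ a ⁆) (U s) (λ v → eL s v ⊔ d a v) (eU s) (queries s + 2))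
    -- e_L(u) = e(u): query from u, add u to U
    stepU : ∀ {s u} → Chosen s u → eL s u ≡ ecc u →
            Step r s (st (L s) (U s ∪ ⁅ u ⁆) (eL s) (λ v → eU s v ⊓∞ fin (d u v + ecc u)) (queries s + 1))

  Reachable : (Fin n → ℕ) → State → Set
  Reachable r s = Star (Step r) initial s

  CorrectOutput : (Fin n → ℕ) → State → Set
  CorrectOutput r s =
      (∀ v → eU s v ≡ fin (ecc v))
    × TightLower (L s)
    × (∀ x → x ∈ L s → ∃ λ u → IsAntipode r u x)
    × (∀ x → (x ∈ U s → InUprec x) × (InUprec x → x ∈ U s))
    × (TightUpper (U s)
       × (∀ U′ → TightUpper U′ → ∣ U s ∣ ≤ ∣ U′ ∣ × (∣ U′ ∣ ≡ ∣ U s ∣ → U′ ≡ U s)))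
    × queries s ≡ ∣ U s ∣ + 2 * ∣ L s ∣

-- Each step adds to L or U a node that is not yet there, so Algorithm A stops after at most 2n
-- steps, having made |U| + 2|L| queries. The maintained values are e_L and e^U of the current
-- certificates, so e_L ≤ e ≤ e^U throughout; at a halting state e^U(v) ≤ e_L(v) for every v,
-- which makes both certificates tight.
-- Write x ≼ y when e(x) = d(x,y) + e(y); this is a partial order and U^≼ is its set of maximal
-- nodes. Every tight upper certificate U′ contains each maximal x, because e^U′(x) = e(x) is
-- attained at some y ∈ U′ with x ≼ y. Conversely a node u added to U is maximal: otherwise some
-- maximal x with u ≼ x has e(x) < e(u). If f(x) is finite then f(x) = e_L(x) ≤ e(x) < e(u) = f(u)
-- contradicts the choice of u; if f(x) = ∞ then x ∈ U already, and e^U(u) ≤ d(u,x) + e(x) = e(u)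
-- = e_L(u) contradicts f(u) < ∞. So U = U^≼ lies inside every tight upper certificate, which
-- makes it the unique one of minimum size.

module Submission where

open import Defs
open import Data.Nat using (ℕ; zero; suc; _+_; _*_; _∸_; _⊔_; _≤_; _<_; _<ᵇ_; z≤n; s≤s; _≟_)
open import Data.Nat.Properties
open import Data.Fin using (Fin) renaming (zero to fzero; suc to fsuc)
open import Data.Fin.Properties using (any?) renaming (_≟_ to _≟ᶠ_)
open import Data.Fin.Subset using (Subset; _∈_; _∉_; _∪_; ⁅_⁆; ∣_∣; _⊆_; inside; outside) renaming (⊥ to ∅)
open import Data.Fin.Subset.Properties
  using (x∈p∪q⁻; x∈p∪q⁺; x∈⁅x⁆; x∈⁅y⁆⇒x≡y; ∉⊥; ∪-identityʳ; drop-∷-⊆; p⊆q⇒∣p∣≤∣q∣; ∣p∣≤n; ∣⊥∣≡0)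
open import Data.Vec using (lookup; []; _∷_; here; there)
open import Data.Vec.Properties using ([]=⇒lookup; lookup⇒[]=)
open import Data.List using (List; foldr; allFin) renaming ([] to []ˡ; _∷_ to _∷ˡ_)
open import Data.List.Membership.Propositional using () renaming (_∈_ to _∈ˡ_)
open import Data.List.Membership.Propositional.Properties using (∈-allFin)
open import Data.List.Relation.Unary.Any using () renaming (here to hereˡ; there to thereˡ)
open import Data.Bool using (true; false; if_then_else_)
open import Data.Product using (∃; _×_; _,_; proj₁; proj₂)
open import Data.Product.Relation.Binary.Lex.Strict using (×-Lex; ×-transitive; ×-total₂)
open import Data.Sum using (_⊎_; inj₁; inj₂; [_,_]′)
open import Data.Empty using (⊥; ⊥-elim)
open import Function using (Injective; _on_; _∘′_)
open import Level using (0ℓ)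
open import Relation.Binary using (Rel; Reflexive; Transitive; Total)
open import Relation.Binary.PropositionalEquality
open import Relation.Binary.Construct.Closure.ReflexiveTransitive using (Star; ε; _◅_)
open import Relation.Nullary using (¬_; Dec; yes; no; contradiction; ¬?)
open import Relation.Nullary.Decidable using (decidable-stable; _×-dec_)
open import Relation.Nullary.Reflects using (ofʸ; ofⁿ)
open import Induction.WellFounded using (Acc; acc)
open import Data.Nat.Induction using (<-wellFounded)
open import Data.Nat.Tactic.RingSolver using (solve-∀)

≤∞-refl : ∀ {x} → x ≤∞ x
≤∞-refl {fin m} = fin≤fin ≤-refl
≤∞-refl {∞} = ∞ ≤∞∞

≤∞-trans : ∀ {x y z} → x ≤∞ y → y ≤∞ z → x ≤∞ z
≤∞-trans (fin≤fin p) (fin≤fin q) = fin≤fin (≤-trans p q)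
≤∞-trans {x} _ (_ ≤∞∞) = x ≤∞∞

≤∞-antisym : ∀ {x y} → x ≤∞ y → y ≤∞ x → x ≡ y
≤∞-antisym (fin≤fin p) (fin≤fin q) = cong fin (≤-antisym p q)
≤∞-antisym (_ ≤∞∞) (_ ≤∞∞) = refl

≤∞-total : ∀ x y → x ≤∞ y ⊎ y ≤∞ x
≤∞-total (fin m) (fin k) with ≤-total m k
... | inj₁ m≤k = inj₁ (fin≤fin m≤k)
... | inj₂ k≤m = inj₂ (fin≤fin k≤m)
≤∞-total x ∞ = inj₁ (x ≤∞∞)
≤∞-total ∞ y = inj₂ (y ≤∞∞)

≤∞-finite : ∀ {x y} → x ≤∞ y → y ≢ ∞ → ∃ λ k → x ≡ fin k
≤∞-finite (fin≤fin {m} _) _ = m , refl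
≤∞-finite (_ ≤∞∞) y≢∞ = contradiction refl y≢∞

is∞? : ∀ x → Dec (x ≡ ∞)
is∞? (fin _) = no λ ()
is∞? ∞ = yes refl

fin≤fin⁻¹ : ∀ {m k} → fin m ≤∞ fin k → m ≤ k
fin≤fin⁻¹ (fin≤fin m≤k) = m≤k

∞≰fin : ∀ {k} → ¬ (∞ ≤∞ fin k)
∞≰fin ()

⊓∞-sel : ∀ x y → x ⊓∞ y ≡ x ⊎ x ⊓∞ y ≡ y
⊓∞-sel ∞ y = inj₂ refl
⊓∞-sel (fin m) ∞ = inj₁ refl
⊓∞-sel (fin m) (fin k) with m <ᵇ k
... | true = inj₁ refl
... | false = inj₂ refl

x⊓∞y≤∞x : ∀ x y → (x ⊓∞ y) ≤∞ x
x⊓∞y≤∞x ∞ y = y ≤∞∞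
x⊓∞y≤∞x (fin m) ∞ = ≤∞-refl
x⊓∞y≤∞x (fin m) (fin k) with m <ᵇ k | <ᵇ-reflects-< m k
... | true | _ = ≤∞-refl
... | false | ofⁿ m≮k = fin≤fin (≮⇒≥ m≮k)

x⊓∞y≤∞y : ∀ x y → (x ⊓∞ y) ≤∞ y
x⊓∞y≤∞y ∞ y = ≤∞-refl
x⊓∞y≤∞y (fin m) ∞ = fin m ≤∞∞
x⊓∞y≤∞y (fin m) (fin k) with m <ᵇ k | <ᵇ-reflects-< m k
... | true | ofʸ m<k = fin≤fin (<⇒≤ m<k)
... | false | _ = ≤∞-refl

⊓∞-glb : ∀ {x y z} → z ≤∞ x → z ≤∞ y → z ≤∞ (x ⊓∞ y)
⊓∞-glb {x} {y} z≤x z≤y with ⊓∞-sel x y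
... | inj₁ x⊓y≡x rewrite x⊓y≡x = z≤x
... | inj₂ x⊓y≡y rewrite x⊓y≡y = z≤y

module _ {n} (d : Fin n → Fin n → ℕ) where

  fval-fin : ∀ e ℓ {k} → fval d e ℓ ≡ fin k → k ≡ ℓ × ¬ (e ≤∞ fin ℓ)
  fval-fin ∞ ℓ refl = refl , ∞≰fin
  fval-fin (fin m) ℓ f≡k with ℓ <ᵇ m | <ᵇ-reflects-< ℓ m
  fval-fin (fin m) ℓ refl | true | ofʸ ℓ<m = refl , λ m≤ℓ → <⇒≱ ℓ<m (fin≤fin⁻¹ m≤ℓ)
  fval-fin (fin m) ℓ () | false | _

  fval-∞ : ∀ e ℓ → fval d e ℓ ≡ ∞ → e ≤∞ fin ℓ
  fval-∞ (fin m) ℓ f≡∞ with ℓ <ᵇ m | <ᵇ-reflects-< ℓ m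
  fval-∞ (fin m) ℓ () | true | _
  fval-∞ (fin m) ℓ refl | false | ofⁿ ℓ≮m = fin≤fin (≮⇒≥ ℓ≮m)

Fin-argmax : ∀ {n ℓ} (_≲_ : Rel (Fin n) ℓ) → Reflexive _≲_ → Transitive _≲_ → Total _≲_ →
             Fin n → ∃ λ a → ∀ v → v ≲ a
Fin-argmax {suc zero} _ ≲-refl _ _ _ = fzero , λ { fzero → ≲-refl }
Fin-argmax {suc (suc n)} _≲_ ≲-refl ≲-trans ≲-total _
  with Fin-argmax (λ x y → fsuc x ≲ fsuc y) ≲-refl ≲-trans (λ x y → ≲-total (fsuc x) (fsuc y)) fzero
... | a , a-max with ≲-total fzero (fsuc a)
...   | inj₁ 0≲a = fsuc a , λ { fzero → 0≲a ; (fsuc v) → a-max v }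
...   | inj₂ a≲0 = fzero , λ { fzero → ≲-refl ; (fsuc v) → ≲-trans (a-max v) a≲0 }

x∈p∪⁅y⁆⁻ : ∀ {n} {x y : Fin n} (p : Subset n) → x ∈ p ∪ ⁅ y ⁆ → x ∈ p ⊎ x ≡ y
x∈p∪⁅y⁆⁻ {y = y} p x∈ with x∈p∪q⁻ p ⁅ y ⁆ x∈
... | inj₁ x∈p = inj₁ x∈p
... | inj₂ x∈⁅y⁆ = inj₂ (x∈⁅y⁆⇒x≡y y x∈⁅y⁆)

∣p∪⁅x⁆∣≡1+∣p∣ : ∀ {n} (p : Subset n) {x} → x ∉ p → ∣ p ∪ ⁅ x ⁆ ∣ ≡ suc ∣ p ∣
∣p∪⁅x⁆∣≡1+∣p∣ (inside ∷ p) {fzero} x∉p = contradiction here x∉p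
∣p∪⁅x⁆∣≡1+∣p∣ (outside ∷ p) {fzero} _ = cong (suc ∘′ ∣_∣) (∪-identityʳ p)
∣p∪⁅x⁆∣≡1+∣p∣ (inside ∷ p) {fsuc x} x∉p = cong suc (∣p∪⁅x⁆∣≡1+∣p∣ p (λ x∈p → x∉p (there x∈p)))
∣p∪⁅x⁆∣≡1+∣p∣ (outside ∷ p) {fsuc x} x∉p = ∣p∪⁅x⁆∣≡1+∣p∣ p (λ x∈p → x∉p (there x∈p))

n∸∣p∪⁅x⁆∣<n∸∣p∣ : ∀ {n} (p : Subset n) {x} → x ∉ p → n ∸ ∣ p ∪ ⁅ x ⁆ ∣ < n ∸ ∣ p ∣
n∸∣p∪⁅x⁆∣<n∸∣p∣ p {x} x∉p = ∸-monoʳ-< (≤-reflexive (sym (∣p∪⁅x⁆∣≡1+∣p∣ p x∉p))) (∣p∣≤n (p ∪ ⁅ x ⁆))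

p⊆q∧∣p∣≡∣q∣⇒p≡q : ∀ {n} {p q : Subset n} → p ⊆ q → ∣ p ∣ ≡ ∣ q ∣ → p ≡ q
p⊆q∧∣p∣≡∣q∣⇒p≡q {p = []} {[]} _ _ = refl
p⊆q∧∣p∣≡∣q∣⇒p≡q {p = inside ∷ p} {inside ∷ q} p⊆q eq =
  cong (inside ∷_) (p⊆q∧∣p∣≡∣q∣⇒p≡q (drop-∷-⊆ p⊆q) (suc-injective eq))
p⊆q∧∣p∣≡∣q∣⇒p≡q {p = outside ∷ p} {outside ∷ q} p⊆q eq =
  cong (outside ∷_) (p⊆q∧∣p∣≡∣q∣⇒p≡q (drop-∷-⊆ p⊆q) eq)
p⊆q∧∣p∣≡∣q∣⇒p≡q {p = inside ∷ p} {outside ∷ q} p⊆q eq with () ← p⊆q here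
p⊆q∧∣p∣≡∣q∣⇒p≡q {p = outside ∷ p} {inside ∷ q} p⊆q eq =
  contradiction eq (<⇒≢ (s≤s (p⊆q⇒∣p∣≤∣q∣ (drop-∷-⊆ p⊆q))))

module _ {n} (S : Subset n) (g : Fin n → ℕ) where

  maxOver : List (Fin n) → ℕ
  maxOver = foldr (λ x m → if lookup S x then g x ⊔ m else m) 0

  minOver : List (Fin n) → ℕ∞
  minOver = foldr (λ x m → if lookup S x then fin (g x) ⊓∞ m else m) ∞

  maxOver-ub : ∀ {x} xs → x ∈ S → x ∈ˡ xs → g x ≤ maxOver xs
  maxOver-ub (y ∷ˡ xs) x∈S (hereˡ refl) rewrite []=⇒lookup x∈S = m≤m⊔n _ _
  maxOver-ub (y ∷ˡ xs) x∈S (thereˡ x∈xs) with lookup S y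
  ... | true = m≤n⇒m≤o⊔n (g y) (maxOver-ub xs x∈S x∈xs)
  ... | false = maxOver-ub xs x∈S x∈xs

  maxOver-lub : ∀ {k} xs → (∀ x → x ∈ S → g x ≤ k) → maxOver xs ≤ k
  maxOver-lub []ˡ _ = z≤n
  maxOver-lub (y ∷ˡ xs) g≤k with lookup S y in y∈S
  ... | true = ⊔-lub (g≤k y (lookup⇒[]= y S y∈S)) (maxOver-lub xs g≤k)
  ... | false = maxOver-lub xs g≤k

  minOver-lb : ∀ {x} xs → x ∈ S → x ∈ˡ xs → minOver xs ≤∞ fin (g x)
  minOver-lb (y ∷ˡ xs) x∈S (hereˡ refl) rewrite []=⇒lookup x∈S = x⊓∞y≤∞x (fin (g y)) (minOver xs)
  minOver-lb (y ∷ˡ xs) x∈S (thereˡ x∈xs) with lookup S y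
  ... | true = ≤∞-trans (x⊓∞y≤∞y (fin (g y)) (minOver xs)) (minOver-lb xs x∈S x∈xs)
  ... | false = minOver-lb xs x∈S x∈xs

  minOver-glb : ∀ {e} xs → (∀ x → x ∈ S → e ≤∞ fin (g x)) → e ≤∞ minOver xs
  minOver-glb {e} []ˡ _ = e ≤∞∞
  minOver-glb (y ∷ˡ xs) e≤g with lookup S y in y∈S
  ... | true = ⊓∞-glb (e≤g y (lookup⇒[]= y S y∈S)) (minOver-glb xs e≤g)
  ... | false = minOver-glb xs e≤g

  minOver≤fin⇒∃ : ∀ {k} xs → minOver xs ≤∞ fin k → ∃ λ x → x ∈ S × g x ≤ k
  minOver≤fin⇒∃ (y ∷ˡ xs) min≤k with lookup S y in y∈S
  ... | false = minOver≤fin⇒∃ xs min≤k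
  ... | true with ⊓∞-sel (fin (g y)) (minOver xs)
  ...   | inj₁ min≡g = y , lookup⇒[]= y S y∈S , fin≤fin⁻¹ (subst (_≤∞ fin _) min≡g min≤k)
  ...   | inj₂ min≡rest = minOver≤fin⇒∃ xs (subst (_≤∞ fin _) min≡rest min≤k)

module Certificates {n} (d : Fin n → Fin n → ℕ) where

  ecc-ub : ∀ u v → d u v ≤ ecc d u
  ecc-ub u v = go (allFin n) (∈-allFin v)
    where
    go : ∀ xs → v ∈ˡ xs → d u v ≤ foldr (λ w m → d u w ⊔ m) 0 xs
    go (w ∷ˡ xs) (hereˡ refl) = m≤m⊔n _ _
    go (w ∷ˡ xs) (thereˡ v∈xs) = m≤n⇒m≤o⊔n (d u w) (go xs v∈xs)

  ecc-lub : ∀ u {k} → (∀ v → d u v ≤ k) → ecc d u ≤ k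
  ecc-lub u {k} d≤k = go (allFin n)
    where
    go : ∀ xs → foldr (λ w m → d u w ⊔ m) 0 xs ≤ k
    go []ˡ = z≤n
    go (w ∷ˡ xs) = ⊔-lub (d≤k w) (go xs)

  eLower-ub : ∀ L u {x} → x ∈ L → d u x ≤ eLower d L u
  eLower-ub L u {x} x∈L = maxOver-ub L (d u) (allFin n) x∈L (∈-allFin x)

  eLower-lub : ∀ L u {k} → (∀ x → x ∈ L → d u x ≤ k) → eLower d L u ≤ k
  eLower-lub L u = maxOver-lub L (d u) (allFin n)

  eLower-∅ : ∀ u → eLower d ∅ u ≡ 0
  eLower-∅ u = n≤0⇒n≡0 (eLower-lub ∅ u (λ x x∈∅ → contradiction x∈∅ ∉⊥))

  eLower-∪⁅⁆ : ∀ L a u → eLower d (L ∪ ⁅ a ⁆) u ≡ eLower d L u ⊔ d u a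
  eLower-∪⁅⁆ L a u = ≤-antisym
    (eLower-lub (L ∪ ⁅ a ⁆) u bound)
    (⊔-lub (eLower-lub L u λ x x∈L → eLower-ub (L ∪ ⁅ a ⁆) u (x∈p∪q⁺ (inj₁ x∈L)))
           (eLower-ub (L ∪ ⁅ a ⁆) u (x∈p∪q⁺ (inj₂ (x∈⁅x⁆ a)))))
    where
    bound : ∀ x → x ∈ L ∪ ⁅ a ⁆ → d u x ≤ eLower d L u ⊔ d u a
    bound x x∈ with x∈p∪⁅y⁆⁻ L x∈
    ... | inj₁ x∈L = m≤n⇒m≤n⊔o (d u a) (eLower-ub L u x∈L)
    ... | inj₂ refl = m≤n⊔m (eLower d L u) (d u a)

  eUpper-lb : ∀ U u {x} → x ∈ U → eUpper d U u ≤∞ fin (d u x + ecc d x)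
  eUpper-lb U u {x} x∈U = minOver-lb U (λ x → d u x + ecc d x) (allFin n) x∈U (∈-allFin x)

  eUpper-glb : ∀ U u {e} → (∀ x → x ∈ U → e ≤∞ fin (d u x + ecc d x)) → e ≤∞ eUpper d U u
  eUpper-glb U u = minOver-glb U (λ x → d u x + ecc d x) (allFin n)

  eUpper≤fin⇒∃ : ∀ U u {k} → eUpper d U u ≤∞ fin k → ∃ λ x → x ∈ U × d u x + ecc d x ≤ k
  eUpper≤fin⇒∃ U u = minOver≤fin⇒∃ U (λ x → d u x + ecc d x) (allFin n)

  eUpper-∅ : ∀ u → eUpper d ∅ u ≡ ∞
  eUpper-∅ u = ≤∞-antisym (_ ≤∞∞) (eUpper-glb ∅ u λ x x∈∅ → contradiction x∈∅ ∉⊥)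

  eUpper-∪⁅⁆ : ∀ U a u → eUpper d (U ∪ ⁅ a ⁆) u ≡ eUpper d U u ⊓∞ fin (d u a + ecc d a)
  eUpper-∪⁅⁆ U a u = ≤∞-antisym
    (⊓∞-glb (eUpper-glb U u λ x x∈U → eUpper-lb (U ∪ ⁅ a ⁆) u (x∈p∪q⁺ (inj₁ x∈U)))
            (eUpper-lb (U ∪ ⁅ a ⁆) u (x∈p∪q⁺ (inj₂ (x∈⁅x⁆ a)))))
    (eUpper-glb (U ∪ ⁅ a ⁆) u bound)
    where
    bound : ∀ x → x ∈ U ∪ ⁅ a ⁆ → (eUpper d U u ⊓∞ fin (d u a + ecc d a)) ≤∞ fin (d u x + ecc d x)
    bound x x∈ with x∈p∪⁅y⁆⁻ U x∈
    ... | inj₁ x∈U = ≤∞-trans (x⊓∞y≤∞x (eUpper d U u) (fin (d u a + ecc d a))) (eUpper-lb U u x∈U)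
    ... | inj₂ refl = x⊓∞y≤∞y (eUpper d U u) (fin (d u a + ecc d a))

  antipode-exists : ∀ (r : Fin n → ℕ) u → ∃ (IsAntipode d r u)
  antipode-exists r u =
    Fin-argmax (_≤lex_ on key) (inj₂ (refl , ≤-refl)) (λ {v} {w} {x} → lex-trans {key v} {key w} {key x})
               (λ v w → ×-total₂ sym <-cmp ≤-total (key v) (key w)) u
    where
    _≤lex_ : Rel (ℕ × ℕ) 0ℓ
    _≤lex_ = ×-Lex _≡_ _<_ _≤_
    lex-trans : Transitive _≤lex_
    lex-trans = ×-transitive {_≈₁_ = _≡_} {_<₁_ = _<_} {_<₂_ = _≤_}
                  isEquivalence (resp₂ _<_) <-trans ≤-trans
    key : Fin n → ℕ × ℕ
    key v = d u v , r v

  antipode-ecc : ∀ {r u a} → IsAntipode d r u a → ecc d u ≤ d u a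
  antipode-ecc {u = u} {a} a-max = ecc-lub u λ v → [ <⇒≤ , ≤-reflexive ∘′ proj₁ ]′ (a-max v)

module _ {n} (G : Graph n) where

  walk-++ : ∀ {u v w k m} → Walk G u v k → Walk G v w m → Walk G u w (k + m)
  walk-++ here q = q
  walk-++ (step e p) q = step e (walk-++ p q)

  walk-reverse : ∀ {u v k} → Walk G u v k → Walk G v u k
  walk-reverse here = here
  walk-reverse {k = suc k} (step e p) =
    subst (Walk G _ _) (+-comm k 1) (walk-++ (walk-reverse p) (step (Adj-sym G e) here))

  walk-0 : ∀ {u v} → Walk G u v 0 → u ≡ v
  walk-0 here = refl

module ShortestPaths {n} (G : Graph n) (d : Fin n → Fin n → ℕ) (isd : IsShortestPathDistance G d) where
  open Certificates d

  d-triangle : ∀ u v w → d u w ≤ d u v + d v w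
  d-triangle u v w = proj₂ (isd u w) _ (walk-++ G (proj₁ (isd u v)) (proj₁ (isd v w)))

  d-sym : ∀ u v → d u v ≡ d v u
  d-sym u v = ≤-antisym (shorter u v) (shorter v u)
    where
    shorter : ∀ u v → d u v ≤ d v u
    shorter u v = proj₂ (isd u v) _ (walk-reverse G (proj₁ (isd v u)))

  d-refl : ∀ u → d u u ≡ 0
  d-refl u = n≤0⇒n≡0 (proj₂ (isd u u) 0 here)

  d≡0⇒≡ : ∀ {u v} → d u v ≡ 0 → u ≡ v
  d≡0⇒≡ {u} {v} d≡0 = walk-0 G (subst (Walk G u v) d≡0 (proj₁ (isd u v)))

  ecc≤d+ecc : ∀ u v → ecc d u ≤ d u v + ecc d v
  ecc≤d+ecc u v = ecc-lub u λ w → ≤-trans (d-triangle u v w) (+-monoʳ-≤ (d u v) (ecc-ub v w))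

  _≼_ : Rel (Fin n) 0ℓ
  x ≼ y = ecc d x ≡ d x y + ecc d y

  ≼-refl : ∀ {x} → x ≼ x
  ≼-refl {x} = cong (_+ ecc d x) (sym (d-refl x))

  ≼-trans : ∀ {x y z} → x ≼ y → y ≼ z → x ≼ z
  ≼-trans {x} {y} {z} x≼y y≼z = ≤-antisym (ecc≤d+ecc x z) (begin
    d x z + ecc d z           ≤⟨ +-monoˡ-≤ (ecc d z) (d-triangle x y z) ⟩
    d x y + d y z + ecc d z   ≡⟨ +-assoc (d x y) (d y z) (ecc d z) ⟩
    d x y + (d y z + ecc d z) ≡⟨ cong (d x y +_) y≼z ⟨
    d x y + ecc d y           ≡⟨ x≼y ⟨
    ecc d x                   ∎)
    where open ≤-Reasoning

  ≼-ecc-< : ∀ {x y} → x ≼ y → y ≢ x → ecc d y < ecc d x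
  ≼-ecc-< {x} {y} x≼y y≢x = begin-strict
    ecc d y            <⟨ +-monoˡ-< (ecc d y) (n≢0⇒n>0 (y≢x ∘′ sym ∘′ d≡0⇒≡)) ⟩
    d x y + ecc d y    ≡⟨ x≼y ⟨
    ecc d x            ∎
    where open ≤-Reasoning

  ≼⇒ecc≥ : ∀ {x y} → x ≼ y → ecc d y ≤ ecc d x
  ≼⇒ecc≥ {x} {y} x≼y = subst (ecc d y ≤_) (sym x≼y) (m≤n+m (ecc d y) (d x y))

  InUprec-above : ∀ x → ∃ λ y → x ≼ y × InUprec d y
  InUprec-above x = go x (<-wellFounded (ecc d x))
    where
    go : ∀ x → Acc _<_ (ecc d x) → ∃ λ y → x ≼ y × InUprec d y
    go x (acc smaller) with any? (λ y → (ecc d x ≟ d x y + ecc d y) ×-dec ¬? (y ≟ᶠ x))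
    ... | yes (y , x≼y , y≢x) =
      let z , y≼z , z-max = go y (smaller (≼-ecc-< x≼y y≢x)) in z , ≼-trans x≼y y≼z , z-max
    ... | no ∄ = x , ≼-refl , λ y x≼y → decidable-stable (y ≟ᶠ x) λ y≢x → ∄ (y , x≼y , y≢x)

  InUprec⇒∈ : ∀ U {x} → InUprec d x → eUpper d U x ≤∞ fin (ecc d x) → x ∈ U
  InUprec⇒∈ U {x} x-max e^U≤e with eUpper≤fin⇒∃ U x e^U≤e
  ... | y , y∈U , d+e≤e = subst (_∈ U) (x-max y (≤-antisym (ecc≤d+ecc x y) d+e≤e)) y∈U

  InUprec⊆tight : ∀ {U x} → TightUpper d U → InUprec d x → x ∈ U
  InUprec⊆tight {U} {x} U-tight x-max =
    InUprec⇒∈ U x-max (subst (_≤∞ fin (ecc d x)) (sym (U-tight x)) ≤∞-refl)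

m+2n+2≡m+2[1+n] : ∀ m n → m + 2 * n + 2 ≡ m + 2 * suc n
m+2n+2≡m+2[1+n] = solve-∀

module AlgorithmA {n} (G : Graph n) (d : Fin n → Fin n → ℕ) (isd : IsShortestPathDistance G d)
                  (r : Fin n → ℕ) where
  open Certificates d
  open ShortestPaths G d isd

  record Invariant (s : State d) : Set where
    field
      eL-correct : ∀ v → eL s v ≡ eLower d (L s) v
      eU-correct : ∀ v → eU s v ≡ eUpper d (U s) v
      queries-correct : queries s ≡ ∣ U s ∣ + 2 * ∣ L s ∣
      L-antipodes : ∀ x → x ∈ L s → ∃ λ u → IsAntipode d r u x
      U⊆InUprec : ∀ x → x ∈ U s → InUprec d x
  open Invariant

  initial-invariant : Invariant (initial d)
  initial-invariant = record
    { eL-correct = λ v → sym (eLower-∅ v)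
    ; eU-correct = λ v → sym (eUpper-∅ v)
    ; queries-correct = cong (λ k → k + 2 * k) (sym (∣⊥∣≡0 n))
    ; L-antipodes = λ _ x∈∅ → contradiction x∈∅ ∉⊥
    ; U⊆InUprec = λ _ x∈∅ → contradiction x∈∅ ∉⊥
    }

  potential : State d → ℕ
  potential s = (n ∸ ∣ L s ∣) + (n ∸ ∣ U s ∣)

  module _ {s : State d} where

    chosen-f≡eL<eU : ∀ u → Chosen d s u → fOf d s u ≡ fin (eL s u) × ¬ (eU s u ≤∞ fin (eL s u))
    chosen-f≡eL<eU u ((k , f≡k) , _) with fval-fin d (eU s u) (eL s u) f≡k
    ... | refl , eU≰eL = f≡k , eU≰eL

    chosen-eU≰ecc : ∀ u → Chosen d s u → eL s u ≡ ecc d u → ¬ (eU s u ≤∞ fin (ecc d u))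
    chosen-eU≰ecc u chosen eL≡ecc rewrite sym eL≡ecc = proj₂ (chosen-f≡eL<eU u chosen)

    module _ (inv : Invariant s) where

      eL≤ecc : ∀ v → eL s v ≤ ecc d v
      eL≤ecc v rewrite eL-correct inv v = eLower-lub (L s) v λ x _ → ecc-ub v x

      ecc≤eU : ∀ v → fin (ecc d v) ≤∞ eU s v
      ecc≤eU v rewrite eU-correct inv v = eUpper-glb (U s) v λ x _ → fin≤fin (ecc≤d+ecc v x)

      eU≤d+ecc : ∀ v {x} → x ∈ U s → eU s v ≤∞ fin (d v x + ecc d x)
      eU≤d+ecc v x∈U rewrite eU-correct inv v = eUpper-lb (U s) v x∈U

      antipode-∉L : ∀ {u a} → eL s u < ecc d u → IsAntipode d r u a → a ∉ L s
      antipode-∉L {u} {a} eL<ecc a-max a∈L = <⇒≱ eL<ecc (begin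
        ecc d u          ≤⟨ antipode-ecc a-max ⟩
        d u a            ≤⟨ eLower-ub (L s) u a∈L ⟩
        eLower d (L s) u ≡⟨ eL-correct inv u ⟨
        eL s u           ∎)
        where open ≤-Reasoning

      chosen-∉U : ∀ u → Chosen d s u → eL s u ≡ ecc d u → u ∉ U s
      chosen-∉U u chosen eL≡ecc u∈U =
        chosen-eU≰ecc u chosen eL≡ecc (subst (λ t → eU s u ≤∞ fin t) (sym ≼-refl) (eU≤d+ecc u u∈U))

      no-InUprec-strictly-above-chosen : ∀ u {x} → Chosen d s u → eL s u ≡ ecc d u →
                                         InUprec d x → u ≼ x → ecc d x < ecc d u → ⊥
      no-InUprec-strictly-above-chosen u {x} chosen eL≡ecc x-max u≼x ecc<ecc with fOf d s x in fx
      ... | fin k = <⇒≱ ecc<ecc (begin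
        ecc d u  ≡⟨ eL≡ecc ⟨
        eL s u   ≤⟨ fin≤fin⁻¹ (subst₂ _≤∞_ (proj₁ (chosen-f≡eL<eU u chosen)) fx (proj₂ chosen x)) ⟩
        k        ≡⟨ proj₁ (fval-fin d (eU s x) (eL s x) fx) ⟩
        eL s x   ≤⟨ eL≤ecc x ⟩
        ecc d x  ∎)
        where open ≤-Reasoning
      ... | ∞ = chosen-eU≰ecc u chosen eL≡ecc (subst (λ t → eU s u ≤∞ fin t) (sym u≼x) (eU≤d+ecc u x∈U))
        where
        eUpper≤ecc : eUpper d (U s) x ≤∞ fin (ecc d x)
        eUpper≤ecc = subst (_≤∞ fin (ecc d x)) (eU-correct inv x)
                       (≤∞-trans (fval-∞ d (eU s x) (eL s x) fx) (fin≤fin (eL≤ecc x)))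
        x∈U : x ∈ U s
        x∈U = InUprec⇒∈ (U s) x-max eUpper≤ecc

      chosen-InUprec : ∀ u → Chosen d s u → eL s u ≡ ecc d u → InUprec d u
      chosen-InUprec u chosen eL≡ecc y u≼y with y ≟ᶠ u
      ... | yes y≡u = y≡u
      ... | no y≢u with InUprec-above y
      ...   | x , y≼x , x-max = ⊥-elim (no-InUprec-strictly-above-chosen u chosen eL≡ecc x-max
                                  (≼-trans u≼y y≼x) (≤-<-trans (≼⇒ecc≥ y≼x) (≼-ecc-< u≼y y≢u)))

      step-invariant : ∀ {s′} → Step d r s s′ → Invariant s′
      step-invariant (stepL {u = u} {a = a} _ eL<ecc a-max) = record
        { eL-correct = λ v → trans (cong₂ _⊔_ (eL-correct inv v) (d-sym a v)) (sym (eLower-∪⁅⁆ (L s) a v))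
        ; eU-correct = eU-correct inv
        ; queries-correct = begin
            queries s + 2                  ≡⟨ cong (_+ 2) (queries-correct inv) ⟩
            ∣ U s ∣ + 2 * ∣ L s ∣ + 2      ≡⟨ m+2n+2≡m+2[1+n] ∣ U s ∣ ∣ L s ∣ ⟩
            ∣ U s ∣ + 2 * suc ∣ L s ∣      ≡⟨ cong (λ l → ∣ U s ∣ + 2 * l) (∣p∪⁅x⁆∣≡1+∣p∣ (L s) a∉L) ⟨
            ∣ U s ∣ + 2 * ∣ L s ∪ ⁅ a ⁆ ∣  ∎
        ; L-antipodes = λ x x∈ → [ L-antipodes inv x , (λ { refl → u , a-max }) ]′ (x∈p∪⁅y⁆⁻ (L s) x∈)
        ; U⊆InUprec = U⊆InUprec inv
        }
        where
        open ≡-Reasoning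
        a∉L : a ∉ L s
        a∉L = antipode-∉L eL<ecc a-max
      step-invariant (stepU {u = u} chosen eL≡ecc) = record
        { eL-correct = eL-correct inv
        ; eU-correct = λ v → trans (cong₂ _⊓∞_ (eU-correct inv v) (cong (λ t → fin (t + ecc d u)) (d-sym u v)))
                                   (sym (eUpper-∪⁅⁆ (U s) u v))
        ; queries-correct = begin
            queries s + 1                  ≡⟨ cong (_+ 1) (queries-correct inv) ⟩
            ∣ U s ∣ + 2 * ∣ L s ∣ + 1      ≡⟨ +-comm _ 1 ⟩
            suc ∣ U s ∣ + 2 * ∣ L s ∣      ≡⟨ cong (_+ 2 * ∣ L s ∣) (∣p∪⁅x⁆∣≡1+∣p∣ (U s) u∉U) ⟨
            ∣ U s ∪ ⁅ u ⁆ ∣ + 2 * ∣ L s ∣  ∎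
        ; L-antipodes = L-antipodes inv
        ; U⊆InUprec = λ x x∈ → [ U⊆InUprec inv x , (λ { refl → chosen-InUprec u chosen eL≡ecc }) ]′
                                 (x∈p∪⁅y⁆⁻ (U s) x∈)
        }
        where
        open ≡-Reasoning
        u∉U : u ∉ U s
        u∉U = chosen-∉U u chosen eL≡ecc

      step-potential : ∀ {s′} → Step d r s s′ → potential s′ < potential s
      step-potential (stepL _ eL<ecc a-max) =
        +-monoˡ-< (n ∸ ∣ U s ∣) (n∸∣p∪⁅x⁆∣<n∸∣p∣ (L s) (antipode-∉L eL<ecc a-max))
      step-potential (stepU {u = u} chosen eL≡ecc) =
        +-monoʳ-< (n ∸ ∣ L s ∣) (n∸∣p∪⁅x⁆∣<n∸∣p∣ (U s) (chosen-∉U u chosen eL≡ecc))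

      chosen-step : ∀ u → Chosen d s u → ∃ (Step d r s)
      chosen-step u chosen with m≤n⇒m<n∨m≡n (eL≤ecc u)
      ... | inj₁ eL<ecc = _ , stepL chosen eL<ecc (proj₂ (antipode-exists r u))
      ... | inj₂ eL≡ecc = _ , stepU chosen eL≡ecc

      progress : Halted d s ⊎ ∃ (Step d r s)
      progress with any? (λ v → ¬? (is∞? (fOf d s v)))
      ... | no ∄ = inj₁ λ v → decidable-stable (is∞? (fOf d s v)) λ f≢∞ → ∄ (v , f≢∞)
      ... | yes (v₀ , f≢∞) with Fin-argmax (λ v w → fOf d s w ≤∞ fOf d s v) ≤∞-refl (λ p q → ≤∞-trans q p)
                                           (λ v w → ≤∞-total (fOf d s w) (fOf d s v)) v₀
      ...   | u , u-min = inj₂ (chosen-step u (≤∞-finite (u-min v₀) f≢∞ , u-min))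

      halted-tight : Halted d s → ∀ v → eU s v ≡ fin (ecc d v) × eL s v ≡ ecc d v
      halted-tight halted v =
          ≤∞-antisym (≤∞-trans eU≤eL (fin≤fin (eL≤ecc v))) (ecc≤eU v)
        , ≤-antisym (eL≤ecc v) (fin≤fin⁻¹ (≤∞-trans (ecc≤eU v) eU≤eL))
        where
        eU≤eL : eU s v ≤∞ fin (eL s v)
        eU≤eL = fval-∞ d (eU s v) (eL s v) (halted v)

      halted-correct : Halted d s → CorrectOutput d r s
      halted-correct halted =
          (λ v → proj₁ (halted-tight halted v))
        , (λ v → trans (sym (eL-correct inv v)) (proj₂ (halted-tight halted v)))
        , L-antipodes inv
        , (λ x → U⊆InUprec inv x , InUprec⊆tight U-tight)
        , (U-tight , λ U′ U′-tight → p⊆q⇒∣p∣≤∣q∣ (U⊆tight {U′} U′-tight)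
                                   , λ ∣U′∣≡∣U∣ → sym (p⊆q∧∣p∣≡∣q∣⇒p≡q (U⊆tight {U′} U′-tight) (sym ∣U′∣≡∣U∣)))
        , queries-correct inv
        where
        U-tight : TightUpper d (U s)
        U-tight v = trans (sym (eU-correct inv v)) (proj₁ (halted-tight halted v))
        U⊆tight : ∀ {U′} → TightUpper d U′ → U s ⊆ U′
        U⊆tight U′-tight x∈U = InUprec⊆tight U′-tight (U⊆InUprec inv _ x∈U)

  accessible : ∀ {s} → Invariant s → Acc _<_ (potential s) → Acc (λ s′ s → Step d r s s′) s
  accessible inv (acc smaller) =
    acc λ s→s′ → accessible (step-invariant inv s→s′) (smaller (step-potential inv s→s′))

  reachable-invariant : ∀ {s s′} → Invariant s → Star (Step d r) s s′ → Invariant s′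
  reachable-invariant inv ε = inv
  reachable-invariant inv (s→s′ ◅ steps) = reachable-invariant (step-invariant inv s→s′) steps

-- Connectedness already follows from d being a shortest-path distance, and injectivity of r
-- only makes the antipode unique.
theorem5 : ∀ {n} (G : Graph n) → Connected G →
    (d : Fin n → Fin n → ℕ) → IsShortestPathDistance G d →
    (r : Fin n → ℕ) → Injective _≡_ _≡_ r →
      Acc (λ s′ s → Step d r s s′) (initial d)
    × (∀ s → Reachable d r s →
         (Halted d s ⊎ ∃ λ s′ → Step d r s s′)
       × (Halted d s → CorrectOutput d r s))
theorem5 G _ d isd r _ =
    accessible initial-invariant (<-wellFounded _)
  , λ s reachable → let inv = reachable-invariant initial-invariant reachable
                    in progress inv , halted-correct inv
  where open AlgorithmA G d isd r
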